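{- For all integers $h,k\geq 2$, the graph $W\langle h,k\rangle$ contains $C\langle h,k-1\rangle$ as a minor.
   Context: Let $T\langle h,k\rangle$ be the rooted complete $k$-ary tree of depth $h$ (each non-leaf node has exactly $k$ children; depth is the number of vertices on a root-to-leaf path). The closure of a rooted tree $T$ is the graph on $V(T)$ where two vertices are adjacent iff one is an ancestor of the other; the weak closure of $T$ is the graph on $V(T)$ where two vertices are adjacent iff one is a leaf and the other is one of its ancestors. $C\langle h,k\rangle$ is the closure and $W\langle h,k\rangle$ the weak closure of $T\langle h,k\rangle$. -}

module Defs where

open import Level using (Level; _⊔_) renaming (suc to lsuc; zero to lzero)
open import Data.Nat using (ℕ; zero; suc)
open import Data.Fin using (Fin)
open import Data.Product using (Σ; ∃; _×_)
open import Data.Sum using (_⊎_)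
open import Relation.Binary.PropositionalEquality using (_≡_)

record Graph : Set₁ where
  field
    Vertex : Set
    Adj    : Vertex → Vertex → Set

open Graph public

data WalkIn (G : Graph) (P : Vertex G → Set) : Vertex G → Vertex G → Set where
  here : ∀ {a} → P a → WalkIn G P a a
  step : ∀ {a b c} → P a → Adj G a b → WalkIn G P b c → WalkIn G P a c

record MinorModel (H G : Graph) : Set₁ where
  field
    branch    : Vertex H → Vertex G → Set
    nonempty  : ∀ x → ∃ (branch x)
    disjoint  : ∀ x y g → branch x g → branch y g → x ≡ y
    connected : ∀ x g g′ → branch x g → branch x g′ → WalkIn G (branch x) g g′
    edges     : ∀ x y → Adj H x y →
                Σ (Vertex G) λ g → Σ (Vertex G) λ g′ →
                  branch x g × branch y g′ × Adj G g g′

IsMinor : Graph → Graph → Set₁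
IsMinor H G = MinorModel H G

-- Nodes of the rooted complete k-ary tree T⟨h,k⟩ of depth h
-- (depth = number of vertices on a root-to-leaf path).

data Node : ℕ → ℕ → Set where
  root  : ∀ {h k} → Node (suc h) k
  child : ∀ {h k} → Fin k → Node h k → Node (suc h) k

data _≺_ : ∀ {h k} → Node h k → Node h k → Set where
  root≺  : ∀ {h k} {i : Fin k} {v : Node h k} → root ≺ child i v
  child≺ : ∀ {h k} {i : Fin k} {u v : Node h k} → u ≺ v → child i u ≺ child i v

data IsLeaf : ∀ {h k} → Node h k → Set where
  leaf-root  : ∀ {k} → IsLeaf (root {0} {k})
  leaf-child : ∀ {h k} {i : Fin k} {v : Node h k} → IsLeaf v → IsLeaf (child i v)

C : ℕ → ℕ → Graph
C h k = record
  { Vertex = Node h k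
  ; Adj    = λ u v → (u ≺ v) ⊎ (v ≺ u) }

W : ℕ → ℕ → Graph
W h k = record
  { Vertex = Node h k
  ; Adj    = λ u v → (IsLeaf v × u ≺ v) ⊎ (IsLeaf u × v ≺ u) }

module Submission where

-- Let k = m + 1.  The complete m-ary tree T⟨h,m⟩ sits inside
-- T⟨h,m+1⟩ by using only the first m children at every node (the map emb).
-- The last child of every internal node of emb T⟨h,m⟩ roots a fresh subtree
-- that emb never touches; we pick its leftmost leaf as the "pendant leaf" of
-- that node.  The branch set of a vertex v of C⟨h,m⟩ is {emb v} together with
-- the pendant leaf of v when v is internal.  Branch sets are disjoint because
-- emb is injective and pendant leaves lie outside its image and determine
-- their node; they are connected because emb v is an ancestor of its pendant
-- leaf, hence adjacent to it in W.  An edge x ≺ y of C⟨h,m⟩ is realised in W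
-- by emb x together with a leaf below emb y: emb y itself when y is a leaf,
-- its pendant leaf otherwise.

open import Defs
open import Data.Nat using (ℕ; _≤_; _∸_; zero; suc)
open import Data.Fin using (Fin; fromℕ; inject₁)
open import Data.Fin.Properties using (fromℕ≢inject₁; inject₁-injective)
open import Data.Product using (Σ; ∃; _×_; _,_)
open import Data.Sum using (_⊎_; inj₁; inj₂)
open import Data.Empty using (⊥; ⊥-elim)
open import Relation.Binary.PropositionalEquality using (_≡_; refl; sym; trans)

_++ʷ_ : ∀ {G : Graph} {P : Vertex G → Set} {a b c} →
        WalkIn G P a b → WalkIn G P b c → WalkIn G P a c
here _     ++ʷ w′ = w′
step p e w ++ʷ w′ = step p e (w ++ʷ w′)

child-injˡ : ∀ {h k} {i j : Fin k} {u v : Node h k} → child i u ≡ child j v → i ≡ j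
child-injˡ refl = refl

child-injʳ : ∀ {h k} {i j : Fin k} {u v : Node h k} → child i u ≡ child j v → u ≡ v
child-injʳ refl = refl

module Embedding (m : ℕ) where

  emb : ∀ {h} → Node h m → Node h (suc m)
  emb root        = root
  emb (child i v) = child (inject₁ i) (emb v)

  emb-injective : ∀ {h} (x y : Node h m) → emb x ≡ emb y → x ≡ y
  emb-injective root        root        _  = refl
  emb-injective (child i x) (child j y) eq
    with inject₁-injective (child-injˡ eq) | emb-injective x y (child-injʳ eq)
  ... | refl | refl = refl

  emb-≺ : ∀ {h} {x y : Node h m} → x ≺ y → emb x ≺ emb y
  emb-≺ root≺      = root≺
  emb-≺ (child≺ p) = child≺ (emb-≺ p)

  emb-leaf : ∀ {h} {y : Node h m} → IsLeaf y → IsLeaf (emb y)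
  emb-leaf leaf-root      = leaf-root
  emb-leaf (leaf-child l) = leaf-child (emb-leaf l)

  leftmost : ∀ h → Node (suc h) (suc m)
  leftmost zero    = root
  leftmost (suc h) = child Fin.zero (leftmost h)

  leftmost-leaf : ∀ h → IsLeaf (leftmost h)
  leftmost-leaf zero    = leaf-root
  leftmost-leaf (suc h) = leaf-child (leftmost-leaf h)

  -- Pendant v g: g is the pendant leaf of the internal node v, i.e. the
  -- leftmost leaf below the new child (index m) of emb v.
  data Pendant : ∀ {h} → Node h m → Node h (suc m) → Set where
    pendant-root  : ∀ {h} → Pendant (root {suc h}) (child (fromℕ m) (leftmost h))
    pendant-child : ∀ {h} {i : Fin m} {v : Node h m} {g} →
                    Pendant v g → Pendant (child i v) (child (inject₁ i) g)

  leaf-or-pendant : ∀ {h} (y : Node h m) → IsLeaf y ⊎ ∃ (Pendant y)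
  leaf-or-pendant (root {zero})  = inj₁ leaf-root
  leaf-or-pendant (root {suc h}) = inj₂ (_ , pendant-root)
  leaf-or-pendant (child i v) with leaf-or-pendant v
  ... | inj₁ l       = inj₁ (leaf-child l)
  ... | inj₂ (g , p) = inj₂ (_ , pendant-child p)

  pendant-leaf : ∀ {h} {y : Node h m} {g} → Pendant y g → IsLeaf g
  pendant-leaf (pendant-root {h}) = leaf-child (leftmost-leaf h)
  pendant-leaf (pendant-child p)  = leaf-child (pendant-leaf p)

  emb≺pendant : ∀ {h} {y : Node h m} {g} → Pendant y g → emb y ≺ g
  emb≺pendant pendant-root      = root≺
  emb≺pendant (pendant-child p) = child≺ (emb≺pendant p)

  ≺-pendant : ∀ {h} {x y : Node h m} {g} → x ≺ y → Pendant y g → emb x ≺ g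
  ≺-pendant root≺      (pendant-child p) = root≺
  ≺-pendant (child≺ q) (pendant-child p) = child≺ (≺-pendant q p)

  pendant∉emb : ∀ {h} {y : Node h m} {g} (x : Node h m) → Pendant y g → g ≡ emb x → ⊥
  pendant∉emb (child i x) pendant-root      eq = fromℕ≢inject₁ (child-injˡ eq)
  pendant∉emb (child i x) (pendant-child p) eq = pendant∉emb x p (child-injʳ eq)

  pendant-injective : ∀ {h} {x y : Node h m} {g g′} → Pendant x g → Pendant y g′ → g ≡ g′ → x ≡ y
  pendant-injective pendant-root      pendant-root      _  = refl
  pendant-injective pendant-root      (pendant-child _) eq = ⊥-elim (fromℕ≢inject₁ (child-injˡ eq))
  pendant-injective (pendant-child _) pendant-root      eq = ⊥-elim (fromℕ≢inject₁ (sym (child-injˡ eq)))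
  pendant-injective (pendant-child p) (pendant-child q) eq
    with inject₁-injective (child-injˡ eq) | pendant-injective p q (child-injʳ eq)
  ... | refl | refl = refl

  Branch : ∀ {h} → Node h m → Node h (suc m) → Set
  Branch v g = (g ≡ emb v) ⊎ Pendant v g

  module _ (h : ℕ) where

    branch-disjoint : ∀ (x y : Node h m) g → Branch x g → Branch y g → x ≡ y
    branch-disjoint x y g (inj₁ p) (inj₁ q) = emb-injective x y (trans (sym p) q)
    branch-disjoint x y g (inj₁ p) (inj₂ q) = ⊥-elim (pendant∉emb x q p)
    branch-disjoint x y g (inj₂ p) (inj₁ q) = ⊥-elim (pendant∉emb y p q)
    branch-disjoint x y g (inj₂ p) (inj₂ q) = pendant-injective p q refl

    to-centre : ∀ (x : Node h m) g → Branch x g → WalkIn (W h (suc m)) (Branch x) g (emb x)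
    to-centre x g (inj₁ refl) = here (inj₁ refl)
    to-centre x g (inj₂ p)    =
      step (inj₂ p) (inj₂ (pendant-leaf p , emb≺pendant p)) (here (inj₁ refl))

    from-centre : ∀ (x : Node h m) g → Branch x g → WalkIn (W h (suc m)) (Branch x) (emb x) g
    from-centre x g (inj₁ refl) = here (inj₁ refl)
    from-centre x g (inj₂ p)    =
      step (inj₁ refl) (inj₁ (pendant-leaf p , emb≺pendant p)) (here (inj₂ p))

    branch-connected : ∀ (x : Node h m) g g′ → Branch x g → Branch x g′ →
                       WalkIn (W h (suc m)) (Branch x) g g′
    branch-connected x g g′ b b′ = to-centre x g b ++ʷ from-centre x g′ b′

    ancestor-edge : ∀ x y → x ≺ y → Σ (Node h (suc m)) λ g → Σ (Node h (suc m)) λ g′ →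
                    Branch x g × Branch y g′ × (IsLeaf g′ × g ≺ g′)
    ancestor-edge x y x≺y with leaf-or-pendant y
    ... | inj₁ l        = emb x , emb y , inj₁ refl , inj₁ refl , emb-leaf l , emb-≺ x≺y
    ... | inj₂ (g′ , p) = emb x , g′ , inj₁ refl , inj₂ p , pendant-leaf p , ≺-pendant x≺y p

    branch-edges : ∀ x y → Adj (C h m) x y → Σ (Node h (suc m)) λ g → Σ (Node h (suc m)) λ g′ →
                   Branch x g × Branch y g′ × Adj (W h (suc m)) g g′
    branch-edges x y (inj₁ x≺y) with ancestor-edge x y x≺y
    ... | g , g′ , b , b′ , e = g , g′ , b , b′ , inj₁ e
    branch-edges x y (inj₂ y≺x) with ancestor-edge y x y≺x
    ... | g , g′ , b , b′ , e = g′ , g , b′ , b , inj₂ e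

    closure-minor-of-weak-closure : IsMinor (C h m) (W h (suc m))
    closure-minor-of-weak-closure = record
      { branch    = Branch
      ; nonempty  = λ x → emb x , inj₁ refl
      ; disjoint  = branch-disjoint
      ; connected = branch-connected
      ; edges     = branch-edges
      }

lemma9 : ∀ (h k : ℕ) → 2 ≤ h → 2 ≤ k → IsMinor (C h (k ∸ 1)) (W h k)
lemma9 h zero    _ ()
lemma9 h (suc m) _ _ = Embedding.closure-minor-of-weak-closure m h
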